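{- For every odd $n\geq 3$, the graph $B_n$ admits a drawing in which both the set of vertices and the set of midpoints of edges are strictly convex, i.e., $B_n\in\mathcal{G}_s^s$. Consequently, $g_s^s(n)\geq\lfloor\frac{3}{2}(n-1)\rfloor$.
   Context: For odd $n\geq 3$, $B_n$ is the graph obtained by taking a triangle $C_3$ and $\frac{n-3}{2}$ copies of the $4$-cycle $C_4$ and identifying all of them along a single common edge $uv$; it has $n$ vertices and $\frac{3}{2}(n-1)$ edges. A finite point set $X\subseteq\mathbb{R}^2$ is strictly convex if every point of $X$ is a vertex of its convex hull. A drawing of a graph is a map of its vertices to $\mathbb{R}^2$, edges drawn as straight segments, such that no two vertices coincide, no two edge midpoints coincide, and no edge midpoint coincides with a vertex. $\mathcal{G}_s^s$ is the class of graphs admitting a drawing whose vertex set and edge-midpoint set are both strictly convex; $g_s^s(n)$ is the maximum number of edges of an $n$-vertex graph in $\mathcal{G}_s^s$. -}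

module Defs where

open import Data.Nat using (ℕ; zero; suc; _+_)
open import Data.Fin using (Fin; zero; suc; _↑ˡ_; _↑ʳ_)
open import Data.List using (List; []; _∷_; concatMap; allFin; length)
open import Data.List.Relation.Unary.All using (All)
open import Data.List.Relation.Unary.AllPairs using (AllPairs)
open import Data.Product using (_×_; _,_; proj₁; proj₂; Σ; swap)
open import Data.Sum using (_⊎_)
open import Data.Rational using (ℚ; 0ℚ; 1ℚ; ½; _≤_) renaming (_+_ to _+ℚ_; _*_ to _*ℚ_)
open import Relation.Binary.PropositionalEquality using (_≡_; _≢_)
open import Relation.Nullary using (¬_)
open import Function.Definitions using (Injective)

Point : Set
Point = ℚ × ℚ

sumFin : (m : ℕ) → (Fin m → ℚ) → ℚ
sumFin zero    f = 0ℚ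
sumFin (suc m) f = f zero +ℚ sumFin m (λ i → f (suc i))

InHullOfOthers : {m : ℕ} → (Fin m → Point) → Fin m → Set
InHullOfOthers {m} p i =
  Σ (Fin m → ℚ) λ λs →
    (∀ j → 0ℚ ≤ λs j) ×
    λs i ≡ 0ℚ ×
    sumFin m λs ≡ 1ℚ ×
    sumFin m (λ j → λs j *ℚ proj₁ (p j)) ≡ proj₁ (p i) ×
    sumFin m (λ j → λs j *ℚ proj₂ (p j)) ≡ proj₂ (p i)

StrictlyConvex : {m : ℕ} → (Fin m → Point) → Set
StrictlyConvex {m} p = Injective _≡_ _≡_ p × (∀ i → ¬ InHullOfOthers p i)

Graph : ℕ → Set
Graph n = List (Fin n × Fin n)

SameEdge : {n : ℕ} → (Fin n × Fin n) → (Fin n × Fin n) → Set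
SameEdge e f = e ≡ f ⊎ e ≡ swap f

IsSimple : {n : ℕ} → Graph n → Set
IsSimple G = All (λ e → proj₁ e ≢ proj₂ e) G × AllPairs (λ e f → ¬ SameEdge e f) G

edgeAt : {n : ℕ} (G : Graph n) → Fin (length G) → Fin n × Fin n
edgeAt (e ∷ G) zero    = e
edgeAt (e ∷ G) (suc i) = edgeAt G i

midpoint : Point → Point → Point
midpoint (a , b) (c , d) = (½ *ℚ (a +ℚ c) , ½ *ℚ (b +ℚ d))

midpoints : {n : ℕ} (G : Graph n) → (Fin n → Point) → Fin (length G) → Point
midpoints G pos i = midpoint (pos (proj₁ (edgeAt G i))) (pos (proj₂ (edgeAt G i)))

IsDrawing : {n : ℕ} → Graph n → (Fin n → Point) → Set
IsDrawing G pos =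
  Injective _≡_ _≡_ pos ×
  Injective _≡_ _≡_ (midpoints G pos) ×
  (∀ i v → midpoints G pos i ≢ pos v)

InGss : {n : ℕ} → Graph n → Set
InGss {n} G = Σ (Fin n → Point) λ pos →
  IsDrawing G pos × StrictlyConvex pos × StrictlyConvex (midpoints G pos)

-- B_n for n = 3 + 2k: vertices u = 0, v = 1, w = 2 (triangle apex),
-- and for each j < k the 4-cycle u - a_j - b_j - v - u with
-- a_j = 3 + j, b_j = 3 + k + j.

B : (k : ℕ) → Graph (3 + (k + k))
B k = (u , v) ∷ (u , w) ∷ (w , v) ∷ concatMap square (allFin k)
  where
  u v w : Fin (3 + (k + k))
  u = zero
  v = suc zero
  w = suc (suc zero)
  a b : Fin k → Fin (3 + (k + k))
  a j = 3 ↑ʳ (j ↑ˡ k)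
  b j = 3 ↑ʳ (k ↑ʳ j)
  square : Fin k → List (Fin (3 + (k + k)) × Fin (3 + (k + k)))
  square j = (u , a j) ∷ (a j , b j) ∷ (b j , v) ∷ []

-- Place vertex x at the point (p, p²) of the parabola y = x², with integer parameters
-- p(u) = 0, p(a_j) = k + 1 + j, p(w) = 4k + 2, p(b_j) = 6k + 4 + j, p(v) = 8k + 4.  A point that
-- is the unique maximiser of a linear functional lies outside the hull of the others, so it
-- suffices to expose every vertex and every edge midpoint by a functional.  The midpoint of the
-- chord with parameters (s, t) is ((s + t)/2, (s² + t²)/2), where (C, -1) takes the value
-- C²/4 - |(s, t) - (C/2, C/2)|²/2: it exposes the midpoint of the chord whose parameter pair is
-- strictly nearest to the diagonal point (C/2, C/2).  Chords through a common endpoint are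
-- centred at their other endpoint, the parallel chords a_j b_j at their own midpoint parameter,
-- and uw, wv at 3k + 3/2 and 5k + 5/2; uv, the pair farthest from (4k + 2, 4k + 2), is exposed
-- by (-(8k + 4), 1) instead.  Vertices are the degenerate chords (p, p).

module Submission where

open import Defs
open import Data.Nat as ℕ using (ℕ; zero; suc)
open import Data.Fin as Fin using (Fin)
open import Data.Product using (Σ; ∃-syntax; _×_; _,_; proj₁; proj₂)
open import Relation.Binary.PropositionalEquality
open import Relation.Nullary using (¬_; yes; no; contradiction)
open import Function.Definitions using (Injective)
open import Data.Sum using (_⊎_; inj₁; inj₂)
open import Relation.Binary using (tri<; tri≈; tri>)
open import Function using (case_of_; _$_)

module ConvexPosition where

  open import Data.List using (List; _∷_; map; length)
  open import Data.List.Relation.Unary.All as All using (All; _∷_)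
  import Data.List.Relation.Unary.All.Properties as All
  open import Data.List.Relation.Unary.AllPairs as AP using (AllPairs; _∷_)
  import Data.List.Relation.Unary.AllPairs.Properties as APP

  open import Data.Rational
  open import Data.Rational.Properties
  open import Data.Rational.Solver using (module +-*-Solver)
  open +-*-Solver

  infix 7 _·_

  _·_ : Point → Point → ℚ
  (a , b) · (x , y) = a * x + b * y

  ·-midpoint : ∀ f p q → f · midpoint p q ≡ ½ * (f · p + f · q)
  ·-midpoint (a , b) (x , y) (x′ , y′) =
    solve 6 (λ a b x y x′ y′ → a :* (con ½ :* (x :+ x′)) :+ b :* (con ½ :* (y :+ y′))
                            := con ½ :* ((a :* x :+ b :* y) :+ (a :* x′ :+ b :* y′)))
      refl a b x y x′ y′

  midpoint-comm : ∀ p q → midpoint p q ≡ midpoint q p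
  midpoint-comm (x , y) (x′ , y′) =
    cong₂ _,_ (cong (½ *_) (+-comm x x′)) (cong (½ *_) (+-comm y y′))

  average-<ʳ : ∀ {p q r} → p ≤ r → q < r → ½ * (p + q) < r
  average-<ʳ {p} {q} {r} p≤r q<r =
    subst (½ * (p + q) <_) (solve 1 (λ r → con ½ :* (r :+ r) := r) refl r)
      (*-monoʳ-<-pos ½ (+-mono-≤-< p≤r q<r))

  average-<ˡ : ∀ {p q r} → p < r → q ≤ r → ½ * (p + q) < r
  average-<ˡ {p} {q} p<r q≤r = subst (_< _) (cong (½ *_) (+-comm q p)) (average-<ʳ q≤r p<r)

  Exposed : ∀ {m} → (Fin m → Point) → Fin m → Set
  Exposed p i = Σ Point λ f → ∀ j → j ≢ i → f · p j < f · p i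

  sumFin-cong : ∀ m {f g : Fin m → ℚ} → (∀ j → f j ≡ g j) → sumFin m f ≡ sumFin m g
  sumFin-cong zero    f≗g = refl
  sumFin-cong (suc m) f≗g = cong₂ _+_ (f≗g Fin.zero) (sumFin-cong m (λ j → f≗g (Fin.suc j)))

  sumFin-+ : ∀ m (f g : Fin m → ℚ) → sumFin m (λ j → f j + g j) ≡ sumFin m f + sumFin m g
  sumFin-+ zero    f g = refl
  sumFin-+ (suc m) f g
    rewrite sumFin-+ m (λ j → f (Fin.suc j)) (λ j → g (Fin.suc j)) =
    solve 4 (λ a b c d → (a :+ b) :+ (c :+ d) := (a :+ c) :+ (b :+ d)) refl
      (f Fin.zero) (g Fin.zero) (sumFin m (λ j → f (Fin.suc j))) (sumFin m (λ j → g (Fin.suc j)))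

  sumFin-*ˡ : ∀ m c (f : Fin m → ℚ) → sumFin m (λ j → c * f j) ≡ c * sumFin m f
  sumFin-*ˡ zero    c f = sym (*-zeroʳ c)
  sumFin-*ˡ (suc m) c f rewrite sumFin-*ˡ m c (λ j → f (Fin.suc j)) =
    sym (*-distribˡ-+ c (f Fin.zero) (sumFin m (λ j → f (Fin.suc j))))

  sumFin-nonNeg : ∀ m (f : Fin m → ℚ) → (∀ j → 0ℚ ≤ f j) → 0ℚ ≤ sumFin m f
  sumFin-nonNeg zero    f f≥0 = ≤-refl
  sumFin-nonNeg (suc m) f f≥0 =
    +-mono-≤ (f≥0 Fin.zero) (sumFin-nonNeg m (λ j → f (Fin.suc j)) (λ j → f≥0 (Fin.suc j)))

  sumFin-pos : ∀ m (f : Fin m → ℚ) → (∀ j → 0ℚ ≤ f j) → ∀ i → 0ℚ < f i → 0ℚ < sumFin m f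
  sumFin-pos (suc m) f f≥0 Fin.zero    fi>0 =
    +-mono-<-≤ fi>0 (sumFin-nonNeg m (λ j → f (Fin.suc j)) (λ j → f≥0 (Fin.suc j)))
  sumFin-pos (suc m) f f≥0 (Fin.suc i) fi>0 =
    +-mono-≤-< (f≥0 Fin.zero) (sumFin-pos m (λ j → f (Fin.suc j)) (λ j → f≥0 (Fin.suc j)) i fi>0)

  sumFin-≢0 : ∀ m (f : Fin m → ℚ) → sumFin m f ≢ 0ℚ → ∃[ j ] f j ≢ 0ℚ
  sumFin-≢0 zero    f Σf≢0 = contradiction refl Σf≢0
  sumFin-≢0 (suc m) f Σf≢0 with f Fin.zero ≟ 0ℚ
  ... | no  f0≢0 = Fin.zero , f0≢0
  ... | yes f0≡0 =
    let j , fj≢0 = sumFin-≢0 m (λ j → f (Fin.suc j)) (λ Σ≡0 → Σf≢0 (cong₂ _+_ f0≡0 Σ≡0))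
    in Fin.suc j , fj≢0

  hull-weighted-gaps≡0 : ∀ {m} (p : Fin m → Point) i f (hull : InHullOfOthers p i) →
                         sumFin m (λ j → proj₁ hull j * (f · p i - f · p j)) ≡ 0ℚ
  hull-weighted-gaps≡0 {m} p i f@(a , b) (λs , _ , _ , Σλs≡1 , Σλsx≡x , Σλsy≡y) = begin
    sumFin m (λ j → λs j * (top - f · p j))
      ≡⟨ sumFin-cong m expand ⟩
    sumFin m (λ j → top * λs j + (- a * (λs j * x j) + - b * (λs j * y j)))
      ≡⟨ sumFin-+ m _ _ ⟩
    sumFin m (λ j → top * λs j) + sumFin m (λ j → - a * (λs j * x j) + - b * (λs j * y j))
      ≡⟨ cong (sumFin m (λ j → top * λs j) +_) (sumFin-+ m _ _) ⟩
    sumFin m (λ j → top * λs j) +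
      (sumFin m (λ j → - a * (λs j * x j)) + sumFin m (λ j → - b * (λs j * y j)))
      ≡⟨ cong₂ _+_ (sumFin-*ˡ m top λs) (cong₂ _+_ (sumFin-*ˡ m (- a) _) (sumFin-*ˡ m (- b) _)) ⟩
    top * sumFin m λs + (- a * sumFin m (λ j → λs j * x j) + - b * sumFin m (λ j → λs j * y j))
      ≡⟨ cong₂ (λ s u → top * s + u) Σλs≡1 (cong₂ (λ u v → - a * u + - b * v) Σλsx≡x Σλsy≡y) ⟩
    top * 1ℚ + (- a * x i + - b * y i)
      ≡⟨ solve 4 (λ a b x y → (a :* x :+ b :* y) :* con 1ℚ :+ ((:- a) :* x :+ (:- b) :* y) := con 0ℚ)
           refl a b (x i) (y i) ⟩
    0ℚ ∎
    where
    open ≡-Reasoning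
    x y : Fin m → ℚ
    x j = proj₁ (p j)
    y j = proj₂ (p j)
    top : ℚ
    top = f · p i
    expand : ∀ j → λs j * (top - f · p j) ≡ top * λs j + (- a * (λs j * x j) + - b * (λs j * y j))
    expand j = solve 6 (λ l t a b x y → l :* (t :- (a :* x :+ b :* y))
                                     := t :* l :+ ((:- a) :* (l :* x) :+ (:- b) :* (l :* y)))
                 refl (λs j) top a b (x j) (y j)

  -- The weighted gaps sum to 0, yet they are nonnegative and one of them is positive.
  exposed⇒¬InHullOfOthers : ∀ {m} (p : Fin m → Point) i → Exposed p i → ¬ InHullOfOthers p i
  exposed⇒¬InHullOfOthers {m} p i (f , f<) hull@(λs , λs≥0 , λsi≡0 , Σλs≡1 , _) =
    <-irrefl (sym (hull-weighted-gaps≡0 p i f hull)) (sumFin-pos m gap gap≥0 j₀ gapj₀>0)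
    where
    gap : Fin m → ℚ
    gap j = λs j * (f · p i - f · p j)
    0<f-gap : ∀ {j} → j ≢ i → 0ℚ < f · p i - f · p j
    0<f-gap {j} j≢i =
      subst (_< f · p i - f · p j) (+-inverseʳ (f · p j)) (+-monoˡ-< (- (f · p j)) (f< j j≢i))
    gap≥0 : ∀ j → 0ℚ ≤ gap j
    gap≥0 j with j Fin.≟ i
    ... | yes refl =
      ≤-reflexive (sym (trans (cong (_* (f · p i - f · p i)) λsi≡0) (*-zeroˡ (f · p i - f · p i))))
    ... | no  j≢i  = subst (_≤ gap j) (*-zeroʳ (λs j))
                       (*-monoˡ-≤-nonNeg (λs j) {{nonNegative (λs≥0 j)}} (<⇒≤ (0<f-gap j≢i)))
    positive-weight : ∃[ j ] λs j ≢ 0ℚ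
    positive-weight = sumFin-≢0 m λs (λ Σ≡0 → 1≢0 (trans (sym Σλs≡1) Σ≡0))
    j₀ : Fin m
    j₀ = proj₁ positive-weight
    j₀≢i : j₀ ≢ i
    j₀≢i refl = proj₂ positive-weight λsi≡0
    λsj₀>0 : 0ℚ < λs j₀
    λsj₀>0 = ≰⇒> (λ λsj₀≤0 → proj₂ positive-weight (≤-antisym λsj₀≤0 (λs≥0 j₀)))
    gapj₀>0 : 0ℚ < gap j₀
    gapj₀>0 = subst (_< gap j₀) (*-zeroʳ (λs j₀)) (*-monoʳ-<-pos (λs j₀) {{positive λsj₀>0}} (0<f-gap j₀≢i))

  exposed⇒injective : ∀ {m} (p : Fin m → Point) → (∀ i → Exposed p i) → Injective _≡_ _≡_ p
  exposed⇒injective p exposed {i} {j} pi≡pj with j Fin.≟ i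
  ... | yes j≡i = sym j≡i
  ... | no  j≢i = let f , f< = exposed i in contradiction (cong (f ·_) (sym pi≡pj)) (<⇒≢ (f< j j≢i))

  exposed⇒strictlyConvex : ∀ {m} (p : Fin m → Point) → (∀ i → Exposed p i) → StrictlyConvex p
  exposed⇒strictlyConvex p exposed =
    exposed⇒injective p exposed , λ i → exposed⇒¬InHullOfOthers p i (exposed i)

  midpoint≢exposed : ∀ {m} (p : Fin m → Point) {i j} → i ≢ j →
                     ∀ x → Exposed p x → midpoint (p i) (p j) ≢ p x
  midpoint≢exposed p {i} {j} i≢j x (f , f<) mid≡px =
    <-irrefl (cong (f ·_) mid≡px) (subst (_< f · p x) (sym (·-midpoint f (p i) (p j))) average<top)
    where
    ≤top : ∀ y → f · p y ≤ f · p x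
    ≤top y with y Fin.≟ x
    ... | yes refl = ≤-refl
    ... | no  y≢x  = <⇒≤ (f< y y≢x)
    average<top : ½ * (f · p i + f · p j) < f · p x
    average<top with i Fin.≟ x
    ... | yes refl = average-<ʳ (≤top i) (f< j (λ j≡i → i≢j (sym j≡i)))
    ... | no  i≢x  = average-<ˡ (f< i i≢x) (≤top j)

  module _ {n : ℕ} {Λ : Set} (edge : Λ → Fin n × Fin n) where

    labelAt : (ls : List Λ) → Fin (length (map edge ls)) → Λ
    labelAt (l ∷ ls) Fin.zero    = l
    labelAt (l ∷ ls) (Fin.suc i) = labelAt ls i

    edgeAt-map : ∀ ls i → edgeAt (map edge ls) i ≡ edge (labelAt ls i)
    edgeAt-map (l ∷ ls) Fin.zero    = refl
    edgeAt-map (l ∷ ls) (Fin.suc i) = edgeAt-map ls i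

    All-labelAt : ∀ {P : Λ → Set} {ls} → All P ls → ∀ i → P (labelAt ls i)
    All-labelAt (pl ∷ _)   Fin.zero    = pl
    All-labelAt (_  ∷ pls) (Fin.suc i) = All-labelAt pls i

    module _ (pos : Fin n → Point) where

      edgeMidpoint : Λ → Point
      edgeMidpoint l = midpoint (pos (proj₁ (edge l))) (pos (proj₂ (edge l)))

      module _ (functional : Λ → Point) where

        Exposes : Λ → Λ → Set
        Exposes l l′ = functional l · edgeMidpoint l′ < functional l · edgeMidpoint l

        MutuallyExposing : Λ → Λ → Set
        MutuallyExposing l l′ = Exposes l l′ × Exposes l′ l

        AllPairs-labelAt : ∀ {ls} → AllPairs MutuallyExposing ls →
                           ∀ {i j} → i ≢ j → Exposes (labelAt ls i) (labelAt ls j)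
        AllPairs-labelAt (_ ∷ _)        {Fin.zero}  {Fin.zero}  i≢j = contradiction refl i≢j
        AllPairs-labelAt (l∼ ∷ _)       {Fin.zero}  {Fin.suc j} _   = proj₁ (All-labelAt l∼ j)
        AllPairs-labelAt (l∼ ∷ _)       {Fin.suc i} {Fin.zero}  _   = proj₂ (All-labelAt l∼ i)
        AllPairs-labelAt (_ ∷ exposing) {Fin.suc i} {Fin.suc j} i≢j =
          AllPairs-labelAt exposing (λ i≡j → i≢j (cong Fin.suc i≡j))

        exposed⇒simple×inGss : ∀ ls → (∀ x → Exposed pos x) →
                               (∀ l → proj₁ (edge l) ≢ proj₂ (edge l)) → AllPairs MutuallyExposing ls →
                               IsSimple (map edge ls) × InGss (map edge ls)
        exposed⇒simple×inGss ls vertexExposed loopless exposing =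
          (All.map⁺ (All.universal loopless ls) , APP.map⁺ (AP.map notSameEdge exposing)) ,
          pos ,
          (exposed⇒injective pos vertexExposed , exposed⇒injective mids midExposed , midpoint≢vertex) ,
          exposed⇒strictlyConvex pos vertexExposed , exposed⇒strictlyConvex mids midExposed
          where
          edgeMidpoint′ : Fin n × Fin n → Point
          edgeMidpoint′ e = midpoint (pos (proj₁ e)) (pos (proj₂ e))
          mids : Fin (length (map edge ls)) → Point
          mids = midpoints (map edge ls) pos
          mids≡ : ∀ i → mids i ≡ edgeMidpoint (labelAt ls i)
          mids≡ i = cong edgeMidpoint′ (edgeAt-map ls i)
          midExposed : ∀ i → Exposed mids i
          midExposed i = functional (labelAt ls i) , λ j j≢i →
            subst₂ (λ m m′ → functional (labelAt ls i) · m < functional (labelAt ls i) · m′)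
              (sym (mids≡ j)) (sym (mids≡ i)) (AllPairs-labelAt exposing (λ i≡j → j≢i (sym i≡j)))
          midpoint≢vertex : ∀ i x → mids i ≢ pos x
          midpoint≢vertex i x = midpoint≢exposed pos
            (subst (λ e → proj₁ e ≢ proj₂ e) (sym (edgeAt-map ls i)) (loopless (labelAt ls i)))
            x (vertexExposed x)
          sameMidpoint : ∀ {l l′} → SameEdge (edge l) (edge l′) → edgeMidpoint l ≡ edgeMidpoint l′
          sameMidpoint (inj₁ e≡e′) = cong edgeMidpoint′ e≡e′
          sameMidpoint {l′ = l′} (inj₂ e≡e′) =
            trans (cong edgeMidpoint′ e≡e′) (midpoint-comm (pos (proj₂ (edge l′))) (pos (proj₁ (edge l′))))
          notSameEdge : ∀ {l l′} → MutuallyExposing l l′ → ¬ SameEdge (edge l) (edge l′)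
          notSameEdge {l} (l′<l , _) same =
            <-irrefl (cong (functional l ·_) (sym (sameMidpoint same))) l′<l

module Nearness where

  open import Data.Nat
  open import Data.Nat.Properties
  open import Data.Nat.Tactic.RingSolver
  open import Data.List using ([]; _∷_)
  open ≤-Reasoning

  Chord : Set
  Chord = ℕ × ℕ

  -- e is strictly nearer than e′ to the diagonal point (C/2, C/2)
  data Nearer (C : ℕ) : Chord → Chord → Set where
    nearer : ∀ {s t s′ t′} → C * (s′ + t′) + (s * s + t * t) < C * (s + t) + (s′ * s′ + t′ * t′) →
             Nearer C (s , t) (s′ , t′)

  nearer-by : ∀ {C s t s′ t′} d →
              C * (s + t) + (s′ * s′ + t′ * t′) ≡ C * (s′ + t′) + (s * s + t * t) + suc d →
              Nearer C (s , t) (s′ , t′)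
  nearer-by {C} {s} {t} {s′} {t′} d eq =
    nearer (subst (C * (s′ + t′) + (s * s + t * t) <_) (sym eq) (m<m+n _ z<s))

  nearer-swap : ∀ {C s t s′ t′} → Nearer C (s , t) (s′ , t′) → Nearer C (t , s) (t′ , s′)
  nearer-swap {C} {s} {t} {s′} {t′} (nearer e<e′) = nearer $
    subst₂ _<_ (cong₂ (λ a b → C * a + b) (+-comm s′ t′) (+-comm (s * s) (t * t)))
               (cong₂ (λ a b → C * a + b) (+-comm s t) (+-comm (s′ * s′) (t′ * t′))) e<e′

  [m+m]*n≤m*m+n*n : ∀ m n → (m + m) * n ≤ m * m + n * n
  [m+m]*n≤m*m+n*n m n with ≤-total m n
  ... | inj₁ m≤n with m≤n⇒∃[o]m+o≡n m≤n
  ...   | d , refl = begin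
    (m + m) * (m + d)          ≤⟨ m≤m+n _ (d * d) ⟩
    (m + m) * (m + d) + d * d  ≡⟨ solve (m ∷ d ∷ []) ⟩
    m * m + (m + d) * (m + d)  ∎
  [m+m]*n≤m*m+n*n m n | inj₂ n≤m with m≤n⇒∃[o]m+o≡n n≤m
  ...   | d , refl = begin
    (n + d + (n + d)) * n          ≤⟨ m≤m+n _ (d * d) ⟩
    (n + d + (n + d)) * n + d * d  ≡⟨ solve (n ∷ d ∷ []) ⟩
    (n + d) * (n + d) + n * n      ∎

  -- Chords sharing the endpoint p compare by the distance of their other endpoint to C/2.
  nearer-pivot-< : ∀ {C p t t′} → t′ < t → t + t′ < C → Nearer C (p , t) (p , t′)
  nearer-pivot-< {C} {p} {t} {t′} t′<t t+t′<C with m≤n⇒∃[o]m+o≡n t′<t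
  ... | d , refl = nearer $ begin-strict
    C * (p + t′) + (p * p + suc (t′ + d) * suc (t′ + d))
      ≡⟨ solve (C ∷ p ∷ t′ ∷ d ∷ []) ⟩
    C * (p + t′) + (p * p + t′ * t′) + (suc (t′ + d) + t′) * suc d
      <⟨ +-monoʳ-< _ (*-monoˡ-< (suc d) t+t′<C) ⟩
    C * (p + t′) + (p * p + t′ * t′) + C * suc d
      ≡⟨ solve (C ∷ p ∷ t′ ∷ d ∷ []) ⟩
    C * (p + suc (t′ + d)) + (p * p + t′ * t′) ∎

  nearer-pivot-> : ∀ {C p t t′} → t < t′ → C < t + t′ → Nearer C (p , t) (p , t′)
  nearer-pivot-> {C} {p} {t} {t′} t<t′ C<t+t′ with m≤n⇒∃[o]m+o≡n t<t′
  ... | d , refl = nearer $ begin-strict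
    C * (p + suc (t + d)) + (p * p + t * t)
      ≡⟨ solve (C ∷ p ∷ t ∷ d ∷ []) ⟩
    C * (p + t) + (p * p + t * t) + C * suc d
      <⟨ +-monoʳ-< _ (*-monoˡ-< (suc d) C<t+t′) ⟩
    C * (p + t) + (p * p + t * t) + (t + suc (t + d)) * suc d
      ≡⟨ solve (C ∷ p ∷ t ∷ d ∷ []) ⟩
    C * (p + t) + (p * p + suc (t + d) * suc (t + d)) ∎

  nearer-pivot : ∀ {p t t′} → t ≢ t′ → Nearer (t + t) (p , t) (p , t′)
  nearer-pivot {p} {t} {t′} t≢t′ with <-cmp t t′
  ... | tri< t<t′ _ _ = nearer-pivot-> t<t′ (+-monoʳ-< t t<t′)
  ... | tri≈ _ t≡t′ _ = contradiction t≡t′ t≢t′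
  ... | tri> _ _ t′<t = nearer-pivot-< t′<t (+-monoʳ-< t t′<t)

  nearer-slide : ∀ {s t x y} → x ≢ y → Nearer ((s + x) + (t + x)) (s + x , t + x) (s + y , t + y)
  nearer-slide {s} {t} {x} {y} x≢y with <-cmp x y
  ... | tri≈ _ x≡y _ = contradiction x≡y x≢y
  ... | tri< x<y _ _ with m≤n⇒∃[o]m+o≡n x<y
  ...   | d , refl = nearer-by (2 * d * d + 4 * d + 1) (solve (s ∷ t ∷ x ∷ d ∷ []))
  nearer-slide {s} {t} {x} {y} x≢y | tri> _ _ y<x with m≤n⇒∃[o]m+o≡n y<x
  ...   | d , refl = nearer-by (2 * d * d + 4 * d + 1) (solve (s ∷ t ∷ y ∷ d ∷ []))

  nearer-far-above : ∀ {t s′ t′} → t + t < t′ → Nearer (t + t) (0 , t) (s′ , t′)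
  nearer-far-above {t} {s′} {t′} t+t<t′ = nearer $ begin-strict
    (t + t) * (s′ + t′) + t * t
      ≡⟨ solve (t ∷ s′ ∷ t′ ∷ []) ⟩
    (t + t) * s′ + ((t + t) * t′ + t * t)
      ≤⟨ +-monoˡ-≤ _ ([m+m]*n≤m*m+n*n t s′) ⟩
    (t * t + s′ * s′) + ((t + t) * t′ + t * t)
      <⟨ +-monoʳ-< (t * t + s′ * s′) (+-monoˡ-< (t * t) (*-monoˡ-< t′ {{t′≢0}} t+t<t′)) ⟩
    (t * t + s′ * s′) + (t′ * t′ + t * t)
      ≡⟨ solve (t ∷ s′ ∷ t′ ∷ []) ⟩
    (t + t) * (0 + t) + (s′ * s′ + t′ * t′) ∎
    where t′≢0 = >-nonZero (≤-<-trans z≤n t+t<t′)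

  nearer-far-below : ∀ {s L s′ t′} → s′ + L < s + s → s′ < L → Nearer (s + s) (s , L) (s′ , t′)
  nearer-far-below {s} {L} {s′} {t′} s′+L<s+s s′<L with m≤n⇒∃[o]m+o≡n s′<L
  ... | d , refl = nearer $ begin-strict
    (s + s) * (s′ + t′) + (s * s + suc (s′ + d) * suc (s′ + d))
      ≡⟨ solve (s ∷ s′ ∷ t′ ∷ d ∷ []) ⟩
    (s + s) * t′ + ((s + s) * s′ + s * s + s′ * s′ + (s′ + suc (s′ + d)) * suc d)
      ≤⟨ +-monoˡ-≤ _ ([m+m]*n≤m*m+n*n s t′) ⟩
    (s * s + t′ * t′) + ((s + s) * s′ + s * s + s′ * s′ + (s′ + suc (s′ + d)) * suc d)
      <⟨ +-monoʳ-< (s * s + t′ * t′) (+-monoʳ-< _ (*-monoˡ-< (suc d) s′+L<s+s)) ⟩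
    (s * s + t′ * t′) + ((s + s) * s′ + s * s + s′ * s′ + (s + s) * suc d)
      ≡⟨ solve (s ∷ s′ ∷ t′ ∷ d ∷ []) ⟩
    (s + s) * (s + suc (s′ + d)) + (s′ * s′ + t′ * t′) ∎

  nearer-diameter : ∀ {L s t} → s < t → t ≤ L → 0 < s ⊎ t < L → Nearer L (s , t) (0 , L)
  nearer-diameter {L} {s} {t} s<t t≤L inner = nearer $ begin-strict
    L * L + (s * s + t * t)  <⟨ +-monoʳ-< (L * L) squares<L* ⟩
    L * L + (L * s + L * t)  ≡⟨ solve (L ∷ s ∷ t ∷ []) ⟩
    L * (s + t) + L * L      ∎
    where
    s<L = <-≤-trans s<t t≤L
    squares<L* : s * s + t * t < L * s + L * t
    squares<L* = case inner of λ where
      (inj₁ 0<s) → +-mono-<-≤ (*-monoˡ-< s {{>-nonZero 0<s}} s<L) (*-monoˡ-≤ t t≤L)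
      (inj₂ t<L) → +-mono-≤-< (*-monoˡ-≤ s (<⇒≤ s<L))
                              (*-monoˡ-< t {{>-nonZero (≤-<-trans z≤n s<t)}} t<L)

module ParabolaChords where

  open import Data.Rational
  open import Data.Rational.Properties
  open import Data.Rational.Solver using (module +-*-Solver)
  open +-*-Solver
  import Data.Nat as ℕ
  import Data.Nat.Properties as ℕ
  open ConvexPosition using (_·_; ·-midpoint; Exposed)
  open Nearness using (Chord; Nearer; nearer; nearer-slide)

  0<1 : 0ℚ < 1ℚ
  0<1 = *<* (ℤ.+<+ (ℕ.s≤s ℕ.z≤n))
    where import Data.Integer as ℤ

  ι : ℕ → ℚ
  ι zero    = 0ℚ
  ι (suc n) = 1ℚ + ι n

  ι-+ : ∀ m n → ι (m ℕ.+ n) ≡ ι m + ι n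
  ι-+ zero    n = sym (+-identityˡ (ι n))
  ι-+ (suc m) n rewrite ι-+ m n = sym (+-assoc 1ℚ (ι m) (ι n))

  ι-* : ∀ m n → ι (m ℕ.* n) ≡ ι m * ι n
  ι-* zero    n = sym (*-zeroˡ (ι n))
  ι-* (suc m) n rewrite ι-+ n (m ℕ.* n) | ι-* m n =
    solve 2 (λ a b → b :+ a :* b := (con 1ℚ :+ a) :* b) refl (ι m) (ι n)

  ι-nonNeg : ∀ n → 0ℚ ≤ ι n
  ι-nonNeg zero    = ≤-refl
  ι-nonNeg (suc n) = +-mono-≤ (<⇒≤ 0<1) (ι-nonNeg n)

  ι-mono-< : ∀ {m n} → m ℕ.< n → ι m < ι n
  ι-mono-< {m} {n} m<n with ℕ.m≤n⇒∃[o]m+o≡n m<n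
  ... | o , refl = begin-strict
    ι m                   ≡⟨ +-identityʳ (ι m) ⟨
    ι m + 0ℚ              <⟨ +-monoʳ-< (ι m) (+-mono-<-≤ 0<1 (ι-nonNeg o)) ⟩
    ι m + ι (suc o)       ≡⟨ ι-+ m (suc o) ⟨
    ι (m ℕ.+ suc o)       ≡⟨ cong ι (ℕ.+-suc m o) ⟩
    ι (suc m ℕ.+ o)       ∎
    where open ≤-Reasoning

  ι-difference-< : ∀ {a b c d} → a ℕ.+ d ℕ.< c ℕ.+ b → ι a - ι b < ι c - ι d
  ι-difference-< {a} {b} {c} {d} a+d<c+b =
    subst₂ _<_ (solve 4 (λ a b c d → (a :+ d) :+ (:- b :- d) := a :- b) refl (ι a) (ι b) (ι c) (ι d))
               (solve 4 (λ a b c d → (c :+ b) :+ (:- b :- d) := c :- d) refl (ι a) (ι b) (ι c) (ι d))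
      (+-monoˡ-< (- ι b - ι d) (subst₂ _<_ (ι-+ a d) (ι-+ c b) (ι-mono-< a+d<c+b)))

  parabola : ℕ → Point
  parabola n = ι n , ι n * ι n

  chordMidpoint : Chord → Point
  chordMidpoint (s , t) = midpoint (parabola s) (parabola t)

  chordMidpoint-diagonal : ∀ n → chordMidpoint (n , n) ≡ parabola n
  chordMidpoint-diagonal n = cong₂ _,_ (half-double (ι n)) (half-double (ι n * ι n))
    where
    half-double : ∀ p → ½ * (p + p) ≡ p
    half-double = solve 1 (λ p → con ½ :* (p :+ p) := p) refl

  lowerFunctional upperFunctional : ℕ → Point
  lowerFunctional C = ι C , - 1ℚ
  upperFunctional C = - ι C , 1ℚ

  lowerFunctional-chordMidpoint : ∀ C s t →
    lowerFunctional C · chordMidpoint (s , t) ≡ ½ * (ι (C ℕ.* (s ℕ.+ t)) - ι (s ℕ.* s ℕ.+ t ℕ.* t))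
  lowerFunctional-chordMidpoint C s t = begin
    lowerFunctional C · chordMidpoint (s , t)
      ≡⟨ ·-midpoint (lowerFunctional C) (parabola s) (parabola t) ⟩
    ½ * (lowerFunctional C · parabola s + lowerFunctional C · parabola t)
      ≡⟨ solve 3 (λ c a b → con ½ :* ((c :* a :+ (:- con 1ℚ) :* (a :* a)) :+
                                      (c :* b :+ (:- con 1ℚ) :* (b :* b)))
                          := con ½ :* (c :* (a :+ b) :- (a :* a :+ b :* b)))
           refl (ι C) (ι s) (ι t) ⟩
    ½ * (ι C * (ι s + ι t) - (ι s * ι s + ι t * ι t))
      ≡⟨ cong₂ (λ a b → ½ * (a - b)) ι-linear ι-quadratic ⟨
    ½ * (ι (C ℕ.* (s ℕ.+ t)) - ι (s ℕ.* s ℕ.+ t ℕ.* t)) ∎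
    where
    open ≡-Reasoning
    ι-linear : ι (C ℕ.* (s ℕ.+ t)) ≡ ι C * (ι s + ι t)
    ι-linear = trans (ι-* C (s ℕ.+ t)) (cong (ι C *_) (ι-+ s t))
    ι-quadratic : ι (s ℕ.* s ℕ.+ t ℕ.* t) ≡ ι s * ι s + ι t * ι t
    ι-quadratic = trans (ι-+ (s ℕ.* s) (t ℕ.* t)) (cong₂ _+_ (ι-* s s) (ι-* t t))

  upperFunctional-· : ∀ C p → upperFunctional C · p ≡ - (lowerFunctional C · p)
  upperFunctional-· C (x , y) =
    solve 3 (λ c x y → (:- c) :* x :+ con 1ℚ :* y := :- (c :* x :+ (:- con 1ℚ) :* y)) refl (ι C) x y

  nearer⇒lower-< : ∀ {C e e′} → Nearer C e e′ →
    lowerFunctional C · chordMidpoint e′ < lowerFunctional C · chordMidpoint e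
  nearer⇒lower-< {C} {s , t} {s′ , t′} (nearer e<e′) =
    subst₂ _<_ (sym (lowerFunctional-chordMidpoint C s′ t′)) (sym (lowerFunctional-chordMidpoint C s t))
      (*-monoʳ-<-pos ½
        (ι-difference-< {C ℕ.* (s′ ℕ.+ t′)} {s′ ℕ.* s′ ℕ.+ t′ ℕ.* t′} {C ℕ.* (s ℕ.+ t)} e<e′))

  nearer⇒upper-< : ∀ {C e e′} → Nearer C e′ e →
    upperFunctional C · chordMidpoint e′ < upperFunctional C · chordMidpoint e
  nearer⇒upper-< {C} {e} {e′} e′-nearer =
    subst₂ _<_ (sym (upperFunctional-· C (chordMidpoint e′)))
               (sym (upperFunctional-· C (chordMidpoint e)))
      (neg-antimono-< (nearer⇒lower-< e′-nearer))

  parabola-exposed : ∀ {m} (param : Fin m → ℕ) → (∀ {x y} → param x ≡ param y → x ≡ y) →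
                     ∀ x → Exposed (λ y → parabola (param y)) x
  parabola-exposed param param-injective x = f , λ y y≢x →
    subst₂ (λ p q → f · p < f · q) (chordMidpoint-diagonal (param y)) (chordMidpoint-diagonal (param x))
      (nearer⇒lower-< (nearer-slide {0} {0} (λ px≡py → y≢x (sym (param-injective px≡py)))))
    where
    f : Point
    f = lowerFunctional (param x ℕ.+ param x)

module Inequalities where

  open import Data.Nat
  open import Data.Nat.Properties using (m≤n⇒∃[o]m+o≡n; m<m+n; m≤n+m; <-≤-trans)
  open import Data.Nat.Tactic.RingSolver
  open import Data.List using ([]; _∷_)
  open Nearness using (Nearer; nearer-by)

  <-by : ∀ {m n} d → n ≡ m + suc d → suc m ≤ n
  <-by {m} d eq = subst (m <_) (sym eq) (m<m+n m z<s)

  0<4k+2 : ∀ k → 0 < 4 * k + 2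
  0<4k+2 k = <-≤-trans z<s (m≤n+m 2 (4 * k))

  4k+2<8k+4 : ∀ k → 4 * k + 2 < 8 * k + 4
  4k+2<8k+4 k = <-by (4 * k + 1) (solve (k ∷ []))

  4k+2<6k+4+y : ∀ k y → 4 * k + 2 < 6 * k + 4 + y
  4k+2<6k+4+y k y = <-by (2 * k + y + 1) (solve (k ∷ y ∷ []))

  1+k+x<6k+4+x : ∀ k x → suc k + x < 6 * k + 4 + x
  1+k+x<6k+4+x k x = <-by (5 * k + 2) (solve (k ∷ x ∷ []))

  6k+3<4k+2+8k+4 : ∀ k → 6 * k + 3 < 4 * k + 2 + (8 * k + 4)
  6k+3<4k+2+8k+4 k = <-by (6 * k + 2) (solve (k ∷ []))

  4k+2+0<10k+5 : ∀ k → 4 * k + 2 + 0 < 10 * k + 5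
  4k+2+0<10k+5 k = <-by (6 * k + 2) (solve (k ∷ []))

  10k+5<4k+2+6k+4+y : ∀ k y → 10 * k + 5 < 4 * k + 2 + (6 * k + 4 + y)
  10k+5<4k+2+6k+4+y k y = <-by y (solve (k ∷ y ∷ []))

  4k+2+8k+4<2[6k+4+x] : ∀ k x → 4 * k + 2 + (8 * k + 4) < 6 * k + 4 + x + (6 * k + 4 + x)
  4k+2+8k+4<2[6k+4+x] k x = <-by (2 * x + 1) (solve (k ∷ x ∷ []))

  1+k+x<4k+2 : ∀ {k x} → x < k → suc k + x < 4 * k + 2
  1+k+x<4k+2 {k} {x} x<k with m≤n⇒∃[o]m+o≡n x<k
  ... | e , refl = <-by (3 * e + 2 * x + 3) (solve (x ∷ e ∷ []))

  2[1+k+x]<4k+2 : ∀ {k x} → x < k → suc k + x + (suc k + x) < 4 * k + 2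
  2[1+k+x]<4k+2 {k} {x} x<k with m≤n⇒∃[o]m+o≡n x<k
  ... | e , refl = <-by (2 * e + 1) (solve (x ∷ e ∷ []))

  4k+2+1+k+x<6k+3 : ∀ {k x} → x < k → 4 * k + 2 + (suc k + x) < 6 * k + 3
  4k+2+1+k+x<6k+3 {k} {x} x<k with m≤n⇒∃[o]m+o≡n x<k
  ... | e , refl = <-by e (solve (x ∷ e ∷ []))

  6k+4+x<8k+4 : ∀ {k x} → x < k → 6 * k + 4 + x < 8 * k + 4
  6k+4+x<8k+4 {k} {x} x<k with m≤n⇒∃[o]m+o≡n x<k
  ... | e , refl = <-by (2 * e + x + 1) (solve (x ∷ e ∷ []))

  -- Edge pairs not covered by the general lemmas of Nearness: after writing k = 1 + x + e where a
  -- bound x < k is needed, the two sides of Nearer differ by 1 + d for the displayed polynomial d.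
  uw-nearer-wv : ∀ k → Nearer (6 * k + 3) (0 , 4 * k + 2) (4 * k + 2 , 8 * k + 4)
  uw-nearer-wv k = nearer-by (16 * k * k + 16 * k + 3) (solve (k ∷ []))

  uw-nearer-ab : ∀ k y → Nearer (6 * k + 3) (0 , 4 * k + 2) (suc k + y , 6 * k + 4 + y)
  uw-nearer-ab k y =
    nearer-by (3 * k * k + 2 * k * y + 2 * y * y + 7 * k + 4 * y + 3) (solve (k ∷ y ∷ []))

  uw-nearer-bv : ∀ k y → Nearer (6 * k + 3) (0 , 4 * k + 2) (6 * k + 4 + y , 8 * k + 4)
  uw-nearer-bv k y =
    nearer-by (24 * k * k + 6 * k * y + y * y + 30 * k + 5 * y + 9) (solve (k ∷ y ∷ []))

  wv-nearer-uw : ∀ k → Nearer (10 * k + 5) (4 * k + 2 , 8 * k + 4) (0 , 4 * k + 2)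
  wv-nearer-uw k = nearer-by (16 * k * k + 16 * k + 3) (solve (k ∷ []))

  wv-nearer-ua : ∀ {k} {y} → y < k → Nearer (10 * k + 5) (4 * k + 2 , 8 * k + 4) (0 , suc k + y)
  wv-nearer-ua {k} {y} y<k with m≤n⇒∃[o]m+o≡n y<k
  ... | e , refl =
    nearer-by (31 * e * e + 54 * e * y + 24 * y * y + 89 * e + 78 * y + 63) (solve (y ∷ e ∷ []))

  wv-nearer-ab : ∀ {k} {y} → y < k →
    Nearer (10 * k + 5) (4 * k + 2 , 8 * k + 4) (suc k + y , 6 * k + 4 + y)
  wv-nearer-ab {k} {y} y<k with m≤n⇒∃[o]m+o≡n y<k
  ... | e , refl =
    nearer-by (7 * e * e + 8 * e * y + 3 * y * y + 19 * e + 13 * y + 13) (solve (y ∷ e ∷ []))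

  ab-nearer-uv : ∀ {k} {x} → x < k →
    Nearer (suc k + x + (6 * k + 4 + x)) (suc k + x , 6 * k + 4 + x) (0 , 8 * k + 4)
  ab-nearer-uv {k} {x} x<k with m≤n⇒∃[o]m+o≡n x<k
  ... | e , refl =
    nearer-by (20 * e * e + 38 * e * x + 20 * x * x + 56 * e + 56 * x + 39) (solve (x ∷ e ∷ []))

  ab-nearer-uw : ∀ k x →
    Nearer (suc k + x + (6 * k + 4 + x)) (suc k + x , 6 * k + 4 + x) (0 , 4 * k + 2)
  ab-nearer-uw k x = nearer-by (6 * k * x + 2 * x * x + 2 * k + 6 * x + 1) (solve (k ∷ x ∷ []))

  ab-nearer-wv : ∀ {k} {x} → x < k →
    Nearer (suc k + x + (6 * k + 4 + x)) (suc k + x , 6 * k + 4 + x) (4 * k + 2 , 8 * k + 4)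
  ab-nearer-wv {k} {x} x<k with m≤n⇒∃[o]m+o≡n x<k
  ... | e , refl = nearer-by (8 * e * e + 6 * e * x + 14 * e + 2 * x + 3) (solve (x ∷ e ∷ []))

  ab-nearer-ua : ∀ {k} {x} {y} → y < k →
    Nearer (suc k + x + (6 * k + 4 + x)) (suc k + x , 6 * k + 4 + x) (0 , suc k + y)
  ab-nearer-ua {k} {x} {y} y<k with m≤n⇒∃[o]m+o≡n y<k
  ... | e , refl =
    nearer-by (6 * e * e + 12 * e * x + 7 * e * y + 2 * x * x + 10 * x * y + 2 * y * y
               + 22 * e + 20 * x + 14 * y + 19)
              (solve (x ∷ y ∷ e ∷ []))

  ab-nearer-bv : ∀ {k} {x} {y} → x < k →
    Nearer (suc k + x + (6 * k + 4 + x)) (suc k + x , 6 * k + 4 + x) (6 * k + 4 + y , 8 * k + 4)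
  ab-nearer-bv {k} {x} {y} x<k with m≤n⇒∃[o]m+o≡n x<k
  ... | e , refl =
    nearer-by (14 * e * e + 14 * e * x + 5 * e * y + 2 * x * x + 3 * x * y + y * y
               + 34 * e + 14 * x + 8 * y + 19)
              (solve (x ∷ y ∷ e ∷ []))

  length-B-formula : ∀ k → (3 + 3 * k) * 2 ≡ 3 * (2 + (k + k))
  length-B-formula = solve-∀

module Drawing (k : ℕ) where

  open import Data.Nat
  open import Data.Nat.Properties
  open import Data.Nat.DivMod using (m*n/n≡m)
  open import Data.Fin as Fin using (Fin; toℕ; splitAt; _↑ˡ_; _↑ʳ_; join)
  open import Data.Fin.Properties using (splitAt-↑ˡ; splitAt-↑ʳ; join-splitAt; toℕ<n; toℕ-injective)
  open import Data.Sum using (inj₁; inj₂; [_,_]′)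
  open import Data.List using (List; []; _∷_; map; concatMap; allFin; length)
  open import Data.List.Properties using (map-concatMap; length-map; length-tabulate)
  open import Data.List.Relation.Unary.All as All using (All; []; _∷_)
  import Data.List.Relation.Unary.All.Properties as All
  open import Data.List.Relation.Unary.AllPairs as AP using (AllPairs; []; _∷_)
  import Data.List.Relation.Unary.AllPairs.Properties as APP
  import Data.List.Relation.Unary.Unique.Propositional.Properties as Unique
  open import Function using (_∘′_)
  import Data.Rational as ℚ
  open ConvexPosition
  open Nearness
  open ParabolaChords
  open Inequalities

  V : Set
  V = Fin (3 + (k + k))

  u v w : V
  u = Fin.zero
  v = Fin.suc Fin.zero
  w = Fin.suc (Fin.suc Fin.zero)

  a b : Fin k → V
  a j = 3 ↑ʳ (j ↑ˡ k)
  b j = 3 ↑ʳ (k ↑ʳ j)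

  param : V → ℕ
  param Fin.zero                         = 0
  param (Fin.suc Fin.zero)               = 8 * k + 4
  param (Fin.suc (Fin.suc Fin.zero))     = 4 * k + 2
  param (Fin.suc (Fin.suc (Fin.suc x)))  =
    [ (λ j → suc k + toℕ j) , (λ j → 6 * k + 4 + toℕ j) ]′ (splitAt k x)

  param-a : ∀ j → param (a j) ≡ suc k + toℕ j
  param-a j rewrite splitAt-↑ˡ k j k = refl

  param-b : ∀ j → param (b j) ≡ 6 * k + 4 + toℕ j
  param-b j rewrite splitAt-↑ʳ k k j = refl

  data VertexView : V → Set where
    u-view : VertexView u
    v-view : VertexView v
    w-view : VertexView w
    a-view : ∀ j → VertexView (a j)
    b-view : ∀ j → VertexView (b j)

  view : ∀ x → VertexView x
  view Fin.zero                        = u-view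
  view (Fin.suc Fin.zero)              = v-view
  view (Fin.suc (Fin.suc Fin.zero))    = w-view
  view (Fin.suc (Fin.suc (Fin.suc x))) = from-split x (splitAt k x) (join-splitAt k k x)
    where
    from-split : ∀ x s → join k k s ≡ x → VertexView (Fin.suc (Fin.suc (Fin.suc x)))
    from-split _ (inj₁ j) refl = a-view j
    from-split _ (inj₂ j) refl = b-view j

  0<a : ∀ (j : Fin k) → 0 < suc k + toℕ j
  0<a j = z<s

  a<w : ∀ (j : Fin k) → suc k + toℕ j < 4 * k + 2
  a<w j = 1+k+x<4k+2 (toℕ<n j)

  w<b : ∀ (j : Fin k) → 4 * k + 2 < 6 * k + 4 + toℕ j
  w<b j = 4k+2<6k+4+y k (toℕ j)

  b<v : ∀ (j : Fin k) → 6 * k + 4 + toℕ j < 8 * k + 4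
  b<v j = 6k+4+x<8k+4 (toℕ<n j)

  0<w : 0 < 4 * k + 2
  0<w = 0<4k+2 k

  w<v : 4 * k + 2 < 8 * k + 4
  w<v = 4k+2<8k+4 k

  a<v : ∀ (j : Fin k) → suc k + toℕ j < 8 * k + 4
  a<v j = <-trans (a<w j) w<v

  param-injective : ∀ {x y} → param x ≡ param y → x ≡ y
  param-injective {x} {y} eq with view x | view y
  ... | u-view   | u-view   = refl
  ... | u-view   | v-view   = contradiction eq (<⇒≢ (<-trans 0<w w<v))
  ... | u-view   | w-view   = contradiction eq (<⇒≢ 0<w)
  ... | u-view   | a-view j = contradiction (trans eq (param-a j)) (<⇒≢ (0<a j))
  ... | u-view   | b-view j = contradiction (trans eq (param-b j)) (<⇒≢ (<-trans 0<w (w<b j)))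
  ... | v-view   | u-view   = contradiction eq (>⇒≢ (<-trans 0<w w<v))
  ... | v-view   | v-view   = refl
  ... | v-view   | w-view   = contradiction eq (>⇒≢ w<v)
  ... | v-view   | a-view j = contradiction (trans eq (param-a j)) (>⇒≢ (<-trans (a<w j) w<v))
  ... | v-view   | b-view j = contradiction (trans eq (param-b j)) (>⇒≢ (b<v j))
  ... | w-view   | u-view   = contradiction eq (>⇒≢ 0<w)
  ... | w-view   | v-view   = contradiction eq (<⇒≢ w<v)
  ... | w-view   | w-view   = refl
  ... | w-view   | a-view j = contradiction (trans eq (param-a j)) (>⇒≢ (a<w j))
  ... | w-view   | b-view j = contradiction (trans eq (param-b j)) (<⇒≢ (w<b j))
  ... | a-view i | u-view   = contradiction (trans (sym (param-a i)) eq) (>⇒≢ (0<a i))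
  ... | a-view i | v-view   = contradiction (trans (sym (param-a i)) eq) (<⇒≢ (<-trans (a<w i) w<v))
  ... | a-view i | w-view   = contradiction (trans (sym (param-a i)) eq) (<⇒≢ (a<w i))
  ... | a-view i | a-view j =
    cong a (toℕ-injective (+-cancelˡ-≡ (suc k) _ _ (trans (sym (param-a i)) (trans eq (param-a j)))))
  ... | a-view i | b-view j =
    contradiction (trans (sym (param-a i)) (trans eq (param-b j))) (<⇒≢ (<-trans (a<w i) (w<b j)))
  ... | b-view i | u-view   = contradiction (trans (sym (param-b i)) eq) (>⇒≢ (<-trans 0<w (w<b i)))
  ... | b-view i | v-view   = contradiction (trans (sym (param-b i)) eq) (<⇒≢ (b<v i))
  ... | b-view i | w-view   = contradiction (trans (sym (param-b i)) eq) (>⇒≢ (w<b i))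
  ... | b-view i | a-view j =
    contradiction (trans (sym (param-b i)) (trans eq (param-a j))) (>⇒≢ (<-trans (a<w j) (w<b i)))
  ... | b-view i | b-view j =
    cong b (toℕ-injective (+-cancelˡ-≡ (6 * k + 4) _ _ (trans (sym (param-b i)) (trans eq (param-b j)))))

  data Edge : Set where
    uv uw wv : Edge
    ua ab bv : Fin k → Edge

  edge : Edge → V × V
  edge uv     = u , v
  edge uw     = u , w
  edge wv     = w , v
  edge (ua j) = u , a j
  edge (ab j) = a j , b j
  edge (bv j) = b j , v

  chord : Edge → Chord
  chord uv     = 0 , 8 * k + 4
  chord uw     = 0 , 4 * k + 2
  chord wv     = 4 * k + 2 , 8 * k + 4
  chord (ua j) = 0 , suc k + toℕ j
  chord (ab j) = suc k + toℕ j , 6 * k + 4 + toℕ j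
  chord (bv j) = 6 * k + 4 + toℕ j , 8 * k + 4

  edge-chord : ∀ l → (param (proj₁ (edge l)) , param (proj₂ (edge l))) ≡ chord l
  edge-chord uv     = refl
  edge-chord uw     = refl
  edge-chord wv     = refl
  edge-chord (ua j) = cong (0 ,_) (param-a j)
  edge-chord (ab j) = cong₂ _,_ (param-a j) (param-b j)
  edge-chord (bv j) = cong (_, 8 * k + 4) (param-b j)

  chord-increasing : ∀ l → proj₁ (chord l) < proj₂ (chord l)
  chord-increasing uv     = <-trans 0<w w<v
  chord-increasing uw     = 0<w
  chord-increasing wv     = w<v
  chord-increasing (ua j) = 0<a j
  chord-increasing (ab j) = 1+k+x<6k+4+x k (toℕ j)
  chord-increasing (bv j) = b<v j

  center : Edge → ℕ
  center uv     = 8 * k + 4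
  center uw     = 6 * k + 3
  center wv     = 10 * k + 5
  center (ua j) = suc k + toℕ j + (suc k + toℕ j)
  center (ab j) = suc k + toℕ j + (6 * k + 4 + toℕ j)
  center (bv j) = 6 * k + 4 + toℕ j + (6 * k + 4 + toℕ j)

  -- uv is the only edge whose midpoint lies on the upper hull
  functional : Edge → Point
  functional uv = upperFunctional (center uv)
  functional l  = lowerFunctional (center l)

  ExposesChord : Edge → Chord → Set
  ExposesChord uv e′ = Nearer (center uv) e′ (chord uv)
  ExposesChord l  e′ = Nearer (center l) (chord l) e′

  exposesChord⇒< : ∀ l {e′} → ExposesChord l e′ →
                   functional l · chordMidpoint e′ ℚ.< functional l · chordMidpoint (chord l)
  exposesChord⇒< uv     = nearer⇒upper-<
  exposesChord⇒< uw     = nearer⇒lower-<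
  exposesChord⇒< wv     = nearer⇒lower-<
  exposesChord⇒< (ua j) = nearer⇒lower-<
  exposesChord⇒< (ab j) = nearer⇒lower-<
  exposesChord⇒< (bv j) = nearer⇒lower-<

  ua-far : ∀ {j s′ t′} → 4 * k + 2 ≤ t′ → ExposesChord (ua j) (s′ , t′)
  ua-far {j} w≤t′ = nearer-far-above (<-≤-trans (2[1+k+x]<4k+2 (toℕ<n j)) w≤t′)

  bv-far : ∀ {j s′ t′} → s′ ≤ 4 * k + 2 → ExposesChord (bv j) (s′ , t′)
  bv-far {j} s′≤w = nearer-far-below
    (≤-<-trans (+-monoˡ-≤ (8 * k + 4) s′≤w) (4k+2+8k+4<2[6k+4+x] k (toℕ j)))
    (≤-<-trans s′≤w w<v)

  toℕ-≢ : ∀ {i j : Fin k} c → i ≢ j → c + toℕ i ≢ c + toℕ j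
  toℕ-≢ c i≢j eq = i≢j (toℕ-injective (+-cancelˡ-≡ c _ _ eq))

  exposes : ∀ l l′ → l ≢ l′ → ExposesChord l (chord l′)
  exposes uv     uv     uv≢uv = contradiction refl uv≢uv
  exposes uv     uw     _     = nearer-diameter 0<w (<⇒≤ w<v) (inj₂ w<v)
  exposes uv     wv     _     = nearer-diameter w<v ≤-refl (inj₁ 0<w)
  exposes uv     (ua j) _     = nearer-diameter (0<a j) (<⇒≤ (a<v j)) (inj₂ (a<v j))
  exposes uv     (ab j) _     = nearer-diameter (1+k+x<6k+4+x k (toℕ j)) (<⇒≤ (b<v j)) (inj₁ (0<a j))
  exposes uv     (bv j) _     = nearer-diameter (b<v j) ≤-refl (inj₁ (<-trans 0<w (w<b j)))
  exposes uw     uv     _     = nearer-pivot-> w<v (6k+3<4k+2+8k+4 k)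
  exposes uw     uw     uw≢uw = contradiction refl uw≢uw
  exposes uw     wv     _     = uw-nearer-wv k
  exposes uw     (ua j) _     = nearer-pivot-< (a<w j) (4k+2+1+k+x<6k+3 (toℕ<n j))
  exposes uw     (ab j) _     = uw-nearer-ab k (toℕ j)
  exposes uw     (bv j) _     = uw-nearer-bv k (toℕ j)
  exposes wv     uv     _     = nearer-swap (nearer-pivot-< 0<w (4k+2+0<10k+5 k))
  exposes wv     uw     _     = wv-nearer-uw k
  exposes wv     wv     wv≢wv = contradiction refl wv≢wv
  exposes wv     (ua j) _     = wv-nearer-ua (toℕ<n j)
  exposes wv     (ab j) _     = wv-nearer-ab (toℕ<n j)
  exposes wv     (bv j) _     = nearer-swap (nearer-pivot-> (w<b j) (10k+5<4k+2+6k+4+y k (toℕ j)))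
  exposes (ua i) uv     _     = ua-far (<⇒≤ w<v)
  exposes (ua i) uw     _     = ua-far ≤-refl
  exposes (ua i) wv     _     = ua-far (<⇒≤ w<v)
  exposes (ua i) (ua j) i≢j   = nearer-pivot (toℕ-≢ (suc k) (λ i≡j → i≢j (cong ua i≡j)))
  exposes (ua i) (ab j) _     = ua-far (<⇒≤ (w<b j))
  exposes (ua i) (bv j) _     = ua-far (<⇒≤ w<v)
  exposes (ab i) uv     _     = ab-nearer-uv (toℕ<n i)
  exposes (ab i) uw     _     = ab-nearer-uw k (toℕ i)
  exposes (ab i) wv     _     = ab-nearer-wv (toℕ<n i)
  exposes (ab i) (ua j) _     = ab-nearer-ua (toℕ<n j)
  exposes (ab i) (ab j) i≢j   = nearer-slide (λ i≡j → i≢j (cong ab (toℕ-injective i≡j)))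
  exposes (ab i) (bv j) _     = ab-nearer-bv (toℕ<n i)
  exposes (bv i) uv     _     = bv-far z≤n
  exposes (bv i) uw     _     = bv-far z≤n
  exposes (bv i) wv     _     = bv-far ≤-refl
  exposes (bv i) (ua j) _     = bv-far z≤n
  exposes (bv i) (ab j) _     = bv-far (<⇒≤ (a<w j))
  exposes (bv i) (bv j) i≢j   =
    nearer-swap (nearer-pivot (toℕ-≢ (6 * k + 4) (λ i≡j → i≢j (cong bv i≡j))))

  pos : V → Point
  pos x = parabola (param x)

  edgeMidpoint≡ : ∀ l → edgeMidpoint edge pos l ≡ chordMidpoint (chord l)
  edgeMidpoint≡ l = cong chordMidpoint (edge-chord l)

  edge-exposes : ∀ l l′ → l ≢ l′ → Exposes edge pos functional l l′
  edge-exposes l l′ l≢l′ =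
    subst₂ (λ m m′ → functional l · m ℚ.< functional l · m′)
      (sym (edgeMidpoint≡ l′)) (sym (edgeMidpoint≡ l))
      (exposesChord⇒< l (exposes l l′ l≢l′))

  loopless : ∀ l → proj₁ (edge l) ≢ proj₂ (edge l)
  loopless l endpoints≡ =
    <⇒≢ (subst (λ c → proj₁ c < proj₂ c) (sym (edge-chord l)) (chord-increasing l))
        (cong param endpoints≡)

  square : Fin k → List Edge
  square j = ua j ∷ ab j ∷ bv j ∷ []

  edges : List Edge
  edges = uv ∷ uw ∷ wv ∷ concatMap square (allFin k)

  B≡map-edge : B k ≡ map edge edges
  B≡map-edge =
    cong (λ es → (u , v) ∷ (u , w) ∷ (w , v) ∷ es) (sym (map-concatMap edge square (allFin k)))

  All-squares : ∀ {P : Edge → Set} → (∀ j → All P (square j)) → All P (concatMap square (allFin k))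
  All-squares P-square = All.concat⁺ (All.map⁺ (All.tabulate⁺ P-square))

  edges-distinct : AllPairs _≢_ edges
  edges-distinct =
      ((λ ()) ∷ (λ ()) ∷ All-squares (λ _ → (λ ()) ∷ (λ ()) ∷ (λ ()) ∷ []))
    ∷ ((λ ()) ∷ All-squares (λ _ → (λ ()) ∷ (λ ()) ∷ (λ ()) ∷ []))
    ∷ All-squares (λ _ → (λ ()) ∷ (λ ()) ∷ (λ ()) ∷ [])
    ∷ APP.concat⁺ (All.map⁺ (All.tabulate⁺ (λ _ → square-distinct)))
                  (APP.map⁺ (AP.map squares-disjoint (Unique.allFin⁺ k)))
    where
    square-distinct : ∀ {j} → AllPairs _≢_ (square j)
    square-distinct = ((λ ()) ∷ (λ ()) ∷ []) ∷ ((λ ()) ∷ []) ∷ [] ∷ []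
    squares-disjoint : ∀ {i j} → i ≢ j → All (λ l → All (l ≢_) (square j)) (square i)
    squares-disjoint i≢j =
        ((λ { refl → i≢j refl }) ∷ (λ ()) ∷ (λ ()) ∷ [])
      ∷ ((λ ()) ∷ (λ { refl → i≢j refl }) ∷ (λ ()) ∷ [])
      ∷ ((λ ()) ∷ (λ ()) ∷ (λ { refl → i≢j refl }) ∷ []) ∷ []

  B-simple×inGss : IsSimple (B k) × InGss (B k)
  B-simple×inGss = subst (λ G → IsSimple G × InGss G) (sym B≡map-edge)
    (exposed⇒simple×inGss edge pos functional edges
      (parabola-exposed param param-injective) loopless
      (AP.map (λ {l} {l′} l≢l′ → edge-exposes l l′ l≢l′ , edge-exposes l′ l (l≢l′ ∘′ sym))
              edges-distinct))

  length-B : length (B k) ≡ (3 * ((3 + (k + k)) ∸ 1)) / 2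
  length-B = begin
    length (B k)                        ≡⟨ cong length B≡map-edge ⟩
    length (map edge edges)             ≡⟨ length-map edge edges ⟩
    3 + length (concatMap square (allFin k))
      ≡⟨ cong (3 +_) (length-concatMap-square (allFin k)) ⟩
    3 + 3 * length (allFin k)           ≡⟨ cong (λ n → 3 + 3 * n) (length-tabulate {n = k} (λ j → j)) ⟩
    3 + 3 * k                           ≡⟨ m*n/n≡m (3 + 3 * k) 2 ⟨
    (3 + 3 * k) * 2 / 2                 ≡⟨ cong (_/ 2) (length-B-formula k) ⟩
    (3 * ((3 + (k + k)) ∸ 1)) / 2       ∎
    where
    open ≡-Reasoning
    length-concatMap-square : ∀ js → length (concatMap square js) ≡ 3 * length js
    length-concatMap-square []       = refl
    length-concatMap-square (j ∷ js) =
      trans (cong (3 +_) (length-concatMap-square js)) (sym (*-suc 3 (length js)))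

open import Data.Nat using (_+_; _*_; _∸_; _/_; _≤_)
open import Data.Nat.Properties using (≤-reflexive)
open import Data.List using (length)

theorem7 : (k : ℕ) →
    (IsSimple (B k) × length (B k) ≡ (3 * ((3 + (k + k)) ∸ 1)) / 2 × InGss (B k)) ×
    Σ (Graph (3 + (k + k))) (λ G → IsSimple G × InGss G × (3 * ((3 + (k + k)) ∸ 1)) / 2 ≤ length G)
theorem7 k =
  let simple , inGss = B-simple×inGss
  in (simple , length-B , inGss) , (B k , simple , inGss , ≤-reflexive (sym length-B))
  where open Drawing k
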